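{- Let $L$ be a linearly ordered lattice and $I_1,I_2\in\mathcal{I}_L$. Then $I_1\sqsubseteq I_2$ holds if and only if for each $a_1\in I_1$ there exists $a_2\in I_2$ with $a_1\le a_2$, and for each $b_2\in I_2$ there exists $b_1\in I_1$ with $b_1\le b_2$.
   Context: A subset $I\subseteq L$ is a (preference) interval if for all $a,b\in I$ the set $[a,b]=\{x\in L:a\le x\le b\}$ is contained in $I$; $\mathcal{I}_L$ is the set of nonempty intervals. For nonempty $Y_1,Y_2\subseteq L$, $Y_1\sqsubseteq Y_2$ means $y_1\wedge y_2\in Y_1$ and $y_1\vee y_2\in Y_2$ for all $y_1\in Y_1$, $y_2\in Y_2$. -}

module Defs where

open import Level using (Level; _⊔_)
open import Data.Product using (Σ; ∃; _×_; _,_)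
open import Relation.Unary using (Pred; _∈_)
open import Relation.Binary.Definitions using (Total)
open import Relation.Binary.Lattice.Bundles using (Lattice)

module _ {c ℓ₁ ℓ₂ : Level} (L : Lattice c ℓ₁ ℓ₂) where
  open Lattice L

  IsLinear : Set (c ⊔ ℓ₂)
  IsLinear = Total _≤_

  IsInterval : ∀ {ℓ} → Pred Carrier ℓ → Set (c ⊔ ℓ₂ ⊔ ℓ)
  IsInterval I = ∀ {a b x} → a ∈ I → b ∈ I → a ≤ x → x ≤ b → x ∈ I

  Nonempty : ∀ {ℓ} → Pred Carrier ℓ → Set (c ⊔ ℓ)
  Nonempty I = ∃ λ x → x ∈ I

  IsNonemptyInterval : ∀ {ℓ} → Pred Carrier ℓ → Set (c ⊔ ℓ₂ ⊔ ℓ)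
  IsNonemptyInterval I = Nonempty I × IsInterval I

  _⊑_ : ∀ {ℓ} → Pred Carrier ℓ → Pred Carrier ℓ → Set (c ⊔ ℓ)
  Y₁ ⊑ Y₂ = ∀ {y₁ y₂} → y₁ ∈ Y₁ → y₂ ∈ Y₂ → ((y₁ ∧ y₂) ∈ Y₁) × ((y₁ ∨ y₂) ∈ Y₂)

-- The forward direction holds in any lattice and for arbitrary nonempty
-- sets: a₁ ∨ y₂ ∈ I₂ for a witness y₂ ∈ I₂, and y₁ ∧ b₂ ∈ I₁ for a witness
-- y₁ ∈ I₁.
--
-- An interval containing y₁ contains y₁ ∧ y₂ as soon as it contains some
-- lower bound of y₁ ∧ y₂ (since y₁ ∧ y₂ ≤ y₁); in a linear lattice such a
-- lower bound exists: y₁ itself if y₁ ≤ y₂, and otherwise the element of I₁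
-- below y₂ provided by the hypothesis.
module Submission where

open import Defs
open import Level using (Level; _⊔_)
open import Data.Product using (∃; _×_; _,_)
open import Data.Sum using (inj₁; inj₂)
open import Function.Bundles using (_⇔_; mk⇔)
open import Relation.Unary using (Pred; _∈_)
open import Relation.Binary.Lattice.Bundles using (Lattice)

module _ {c ℓ₁ ℓ₂ : Level} (L : Lattice c ℓ₁ ℓ₂) where
  open Lattice L

  DominatedAbove : ∀ {ℓ} → Pred Carrier ℓ → Pred Carrier ℓ → Set (c ⊔ ℓ ⊔ ℓ₂)
  DominatedAbove Y₁ Y₂ = ∀ {a₁} → a₁ ∈ Y₁ → ∃ λ a₂ → a₂ ∈ Y₂ × a₁ ≤ a₂

  DominatedBelow : ∀ {ℓ} → Pred Carrier ℓ → Pred Carrier ℓ → Set (c ⊔ ℓ ⊔ ℓ₂)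
  DominatedBelow Y₁ Y₂ = ∀ {b₂} → b₂ ∈ Y₂ → ∃ λ b₁ → b₁ ∈ Y₁ × b₁ ≤ b₂

  ⊑⇒dominatedAbove : ∀ {ℓ} {Y₁ Y₂ : Pred Carrier ℓ} →
    Nonempty L Y₂ → _⊑_ L Y₁ Y₂ → DominatedAbove Y₁ Y₂
  ⊑⇒dominatedAbove (y₂ , y₂∈Y₂) Y₁⊑Y₂ {a₁} a₁∈Y₁ =
    let (_ , a₁∨y₂∈Y₂) = Y₁⊑Y₂ a₁∈Y₁ y₂∈Y₂ in a₁ ∨ y₂ , a₁∨y₂∈Y₂ , x≤x∨y a₁ y₂

  ⊑⇒dominatedBelow : ∀ {ℓ} {Y₁ Y₂ : Pred Carrier ℓ} →
    Nonempty L Y₁ → _⊑_ L Y₁ Y₂ → DominatedBelow Y₁ Y₂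
  ⊑⇒dominatedBelow (y₁ , y₁∈Y₁) Y₁⊑Y₂ {b₂} b₂∈Y₂ =
    let (y₁∧b₂∈Y₁ , _) = Y₁⊑Y₂ y₁∈Y₁ b₂∈Y₂ in y₁ ∧ b₂ , y₁∧b₂∈Y₁ , x∧y≤y y₁ b₂

  meet-∈-interval : ∀ {ℓ} {I : Pred Carrier ℓ} → IsInterval L I →
    ∀ {y₁ y₂ b} → y₁ ∈ I → b ∈ I → b ≤ y₁ ∧ y₂ → y₁ ∧ y₂ ∈ I
  meet-∈-interval interval {y₁} {y₂} y₁∈I b∈I b≤y₁∧y₂ =
    interval b∈I y₁∈I b≤y₁∧y₂ (x∧y≤x y₁ y₂)

  join-∈-interval : ∀ {ℓ} {I : Pred Carrier ℓ} → IsInterval L I →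
    ∀ {y₁ y₂ a} → y₂ ∈ I → a ∈ I → y₁ ∨ y₂ ≤ a → y₁ ∨ y₂ ∈ I
  join-∈-interval interval {y₁} {y₂} y₂∈I a∈I y₁∨y₂≤a =
    interval y₂∈I a∈I (y≤x∨y y₁ y₂) y₁∨y₂≤a

  lowerBound-of-meet : ∀ {ℓ} {Y : Pred Carrier ℓ} → IsLinear L →
    ∀ {y₁ y₂} → y₁ ∈ Y → (∃ λ b → b ∈ Y × b ≤ y₂) →
    ∃ λ b → b ∈ Y × b ≤ y₁ ∧ y₂
  lowerBound-of-meet total {y₁} {y₂} y₁∈Y (b , b∈Y , b≤y₂) with total y₁ y₂
  ... | inj₁ y₁≤y₂ = y₁ , y₁∈Y , ∧-greatest refl y₁≤y₂
  ... | inj₂ y₂≤y₁ = b , b∈Y , ∧-greatest (trans b≤y₂ y₂≤y₁) b≤y₂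

  upperBound-of-join : ∀ {ℓ} {Y : Pred Carrier ℓ} → IsLinear L →
    ∀ {y₁ y₂} → y₂ ∈ Y → (∃ λ a → a ∈ Y × y₁ ≤ a) →
    ∃ λ a → a ∈ Y × y₁ ∨ y₂ ≤ a
  upperBound-of-join total {y₁} {y₂} y₂∈Y (a , a∈Y , y₁≤a) with total y₁ y₂
  ... | inj₁ y₁≤y₂ = y₂ , y₂∈Y , ∨-least y₁≤y₂ refl
  ... | inj₂ y₂≤y₁ = a , a∈Y , ∨-least y₁≤a (trans y₂≤y₁ y₁≤a)

  ⊑⇒dominated : ∀ {ℓ} {Y₁ Y₂ : Pred Carrier ℓ} →
    Nonempty L Y₁ → Nonempty L Y₂ →
    _⊑_ L Y₁ Y₂ → DominatedAbove Y₁ Y₂ × DominatedBelow Y₁ Y₂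
  ⊑⇒dominated nonempty₁ nonempty₂ Y₁⊑Y₂ =
    ⊑⇒dominatedAbove nonempty₂ Y₁⊑Y₂ , ⊑⇒dominatedBelow nonempty₁ Y₁⊑Y₂

  dominated⇒⊑ : ∀ {ℓ} {I₁ I₂ : Pred Carrier ℓ} → IsLinear L →
    IsInterval L I₁ → IsInterval L I₂ →
    DominatedAbove I₁ I₂ × DominatedBelow I₁ I₂ → _⊑_ L I₁ I₂
  dominated⇒⊑ total interval₁ interval₂ (above , below) y₁∈I₁ y₂∈I₂ =
    let (b , b∈I₁ , b≤y₁∧y₂) = lowerBound-of-meet total y₁∈I₁ (below y₂∈I₂)
        (a , a∈I₂ , y₁∨y₂≤a) = upperBound-of-join total y₂∈I₂ (above y₁∈I₁)
    in meet-∈-interval interval₁ y₁∈I₁ b∈I₁ b≤y₁∧y₂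
     , join-∈-interval interval₂ y₂∈I₂ a∈I₂ y₁∨y₂≤a

lemma4p5 : ∀ {c ℓ₁ ℓ₂ ℓ} (L : Lattice c ℓ₁ ℓ₂) → IsLinear L →
    (I₁ I₂ : Pred (Lattice.Carrier L) ℓ) →
    IsNonemptyInterval L I₁ → IsNonemptyInterval L I₂ →
    _⊑_ L I₁ I₂ ⇔
    ((∀ {a₁} → a₁ ∈ I₁ → ∃ λ a₂ → a₂ ∈ I₂ × Lattice._≤_ L a₁ a₂)
    × (∀ {b₂} → b₂ ∈ I₂ → ∃ λ b₁ → b₁ ∈ I₁ × Lattice._≤_ L b₁ b₂))
lemma4p5 L total I₁ I₂ (nonempty₁ , interval₁) (nonempty₂ , interval₂) =
  mk⇔ (⊑⇒dominated L nonempty₁ nonempty₂)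
      (dominated⇒⊑ L total interval₁ interval₂)
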